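{- For integers $p\geq 3$ and $k\geq 1$, let $n=|V(Gr(p,k))|=p^2+2kp(p-1)$ and let $\Delta=4k$ be the maximum degree of $Gr(p,k)$. Then $\mathrm{cat}(Gr(p,k))\geq \frac{\sqrt{3}}{6}\sqrt{\Delta n}>0.288\sqrt{\Delta n}$. Moreover, within this family both $\Delta$ and $n$ are arbitrarily large.
   Context: Cat Herding is a two-player game on a finite simple graph $G$ between a cat and a herder. First the cat places its token on a starting vertex. Then the players alternate, the herder moving first: on the herder's turn it deletes one edge of the current graph (a "cut"); on the cat's turn the cat must move its token along a path of the current graph to a different vertex. The game ends when the cat's current vertex has no incident edges. The score is the total number of edges deleted; the herder minimizes and the cat maximizes it. For $v\in V(G)$, $\mathrm{cat}(G,v)$ is the optimal-play score when the cat starts at $v$, and $\mathrm{cat}(G)=\max_{v\in V(G)}\mathrm{cat}(G,v)$. For integers $p,k\geq 1$, $Gr(p,k)$ is obtained from the $p\times p$ grid graph $P_p\square P_p$ by replacing every edge with $k$ parallel edges between the same endpoints and then subdividing every one of these edges by one new vertex; equivalently, each grid edge $uv$ is replaced by $k$ internally disjoint paths $u\,w\,v$ of length $2$ with new middle vertices $w$. These graphs are planar. -}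

module Defs where

open import Data.Nat using (ℕ; zero; suc; _+_; _*_; _∸_; _⊓_; _⊔_)
import Data.Nat as ℕ
open import Data.Bool using (Bool; true; false; not; if_then_else_; _∨_)
open import Data.List using (List; []; _∷_; _++_; map; foldr; length; filter; concatMap; upTo)
open import Data.Bool.ListAction using (any)
open import Data.Product using (_×_; _,_)
open import Relation.Nullary using (Dec; yes; no; ¬_)
open import Relation.Nullary.Decidable using (⌊_⌋)
open import Relation.Binary.Definitions using (DecidableEquality)
open import Relation.Binary.PropositionalEquality using (_≡_; refl; cong; cong₂)

-- Finite (simple) graphs, given by a vertex type with decidable
-- equality, a list of all vertices (without repetition) and a list of
-- edges; an edge (a , b) is the unordered edge {a , b}.

record Graph : Set₁ where
  field
    V        : Set
    _≟V_     : DecidableEquality V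
    vertices : List V
    edges    : List (V × V)

module Game (G : Graph) where
  open Graph G

  Edge : Set
  Edge = V × V

  _==_ : V → V → Bool
  a == b = ⌊ a ≟V b ⌋

  incident : V → Edge → Bool
  incident v (a , b) = (a == v) ∨ (b == v)

  isolated : List Edge → V → Bool
  isolated E v = not (any (incident v) E)

  degree : List Edge → V → ℕ
  degree E v = length (filter (λ e → incident v e ≟B true) E)
    where
    _≟B_ : (x y : Bool) → Dec (x ≡ y)
    _≟B_ = Data.Bool._≟_
      where import Data.Bool

  elem : V → List V → Bool
  elem v = any (v ==_)

  step : List Edge → List V → List V
  step E S = S ++ concatMap nb E
    where
    nb : Edge → List V
    nb (a , b) = (if elem a S then b ∷ [] else []) ++ (if elem b S then a ∷ [] else [])

  -- all vertices joined to v by a path in E (any path has length ≤ |E|)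
  reach : List Edge → V → List V
  reach E v = go (length E) (v ∷ [])
    where
    go : ℕ → List V → List V
    go zero    S = S
    go (suc m) S = go m (step E S)

  catMoves : List Edge → V → List V
  catMoves E v = filter (λ w → ¬? (w ≟V v)) (reach E v)
    where open import Relation.Nullary.Decidable using (¬?)

  removals : List Edge → List (List Edge)
  removals []       = []
  removals (x ∷ xs) = xs ∷ map (x ∷_) (removals xs)

  maxList : List ℕ → ℕ
  maxList = foldr _⊔_ 0

  minList : List ℕ → ℕ
  minList []       = 0
  minList (x ∷ xs) = foldr _⊓_ x xs

  -- herderVal f E v : optimal score (number of further cuts) with the
  -- cat on v, current edge list E, herder to move.  The fuel f is
  -- always length E, which bounds the number of remaining cuts.
  herderVal : ℕ → List Edge → V → ℕ
  herderVal zero    E v = 0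
  herderVal (suc f) E v =
    if isolated E v then 0
    else minList (map (λ E' → suc (catVal E' v)) (removals E))
    where
    catVal : List Edge → V → ℕ
    catVal E' v = if isolated E' v then 0
                  else maxList (map (herderVal f E') (catMoves E' v))

  catAt : V → ℕ
  catAt v = herderVal (length edges) edges v

  catNumber : ℕ
  catNumber = maxList (map catAt vertices)

  maxDegree : ℕ
  maxDegree = maxList (map (degree edges) vertices)

cat : Graph → ℕ
cat G = Game.catNumber G

Δ : Graph → ℕ
Δ G = Game.maxDegree G

∣V∣ : Graph → ℕ
∣V∣ G = length (Graph.vertices G)

-- vertices: grid vertices g i j (0 ≤ i,j < p); middle vertex hm i j t of
-- the t-th path between (i,j) and (i,j+1); middle vertex vm i j t of the
-- t-th path between (i,j) and (i+1,j)   (0 ≤ t < k).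
data GrV : Set where
  g  : ℕ → ℕ → GrV
  hm : ℕ → ℕ → ℕ → GrV
  vm : ℕ → ℕ → ℕ → GrV

_≟GrV_ : DecidableEquality GrV
g i j ≟GrV g i' j' with i ℕ.≟ i' | j ℕ.≟ j'
... | yes refl | yes refl = yes refl
... | no ne | _ = no λ { refl → ne refl }
... | _ | no ne = no λ { refl → ne refl }
g _ _ ≟GrV hm _ _ _ = no λ ()
g _ _ ≟GrV vm _ _ _ = no λ ()
hm _ _ _ ≟GrV g _ _ = no λ ()
hm i j t ≟GrV hm i' j' t' with i ℕ.≟ i' | j ℕ.≟ j' | t ℕ.≟ t'
... | yes refl | yes refl | yes refl = yes refl
... | no ne | _ | _ = no λ { refl → ne refl }
... | _ | no ne | _ = no λ { refl → ne refl }
... | _ | _ | no ne = no λ { refl → ne refl }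
hm _ _ _ ≟GrV vm _ _ _ = no λ ()
vm _ _ _ ≟GrV g _ _ = no λ ()
vm _ _ _ ≟GrV hm _ _ _ = no λ ()
vm i j t ≟GrV vm i' j' t' with i ℕ.≟ i' | j ℕ.≟ j' | t ℕ.≟ t'
... | yes refl | yes refl | yes refl = yes refl
... | no ne | _ | _ = no λ { refl → ne refl }
... | _ | no ne | _ = no λ { refl → ne refl }
... | _ | _ | no ne = no λ { refl → ne refl }

module _ (p k : ℕ) where
  private
    rng : ℕ → List ℕ
    rng = upTo

    for : {A : Set} → ℕ → (ℕ → List A) → List A
    for n f = concatMap f (rng n)

  grVertices : List GrV
  grVertices =
       for p (λ i → for p (λ j → g i j ∷ []))
    ++ for p (λ i → for (p ∸ 1) (λ j → for k (λ t → hm i j t ∷ [])))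
    ++ for (p ∸ 1) (λ i → for p (λ j → for k (λ t → vm i j t ∷ [])))

  grEdges : List (GrV × GrV)
  grEdges =
       for p (λ i → for (p ∸ 1) (λ j → for k (λ t →
         (g i j , hm i j t) ∷ (hm i j t , g i (suc j)) ∷ [])))
    ++ for (p ∸ 1) (λ i → for p (λ j → for k (λ t →
         (g i j , vm i j t) ∷ (vm i j t , g (suc i) j) ∷ [])))

Gr : ℕ → ℕ → Graph
Gr p k = record
  { V = GrV ; _≟V_ = _≟GrV_ ; vertices = grVertices p k ; edges = grEdges p k }

{-# OPTIONS --safe #-}
-- A line of Gr(p,k) is one of the k subdivided copies of a whole row or column. The cat stays
-- on a grid vertex that lies on an intact horizontal and an intact vertical line. A cut breaks
-- at most one line, so one of the two lines through the cat survives, and the cat runs along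
-- it to a grid vertex whose crossing line is intact; such a vertex exists while more than k
-- crossing lines survive, since one row or column carries only k. Starting from pk intact
-- lines in each direction, the herder therefore needs at least 1 + (p - 1)k cuts, and
-- 12 (1 + (p - 1)k)² ≥ 4k (p² + 2kp(p - 1)) = Δ n.
module Submission where

open import Defs
open import Data.Nat using (ℕ; _+_; _*_; _∸_; _≤_; _<_)
open import Data.Product using (_×_; Σ; ∃)
open import Relation.Binary.PropositionalEquality using (_≡_)

open import Data.Bool using (Bool; true; false; not; T; if_then_else_)
import Data.Bool as Bool
open import Data.Bool.Properties using (T-≡; T-∨)
open import Data.List using (List; []; _∷_; _++_; [_]; map; foldr; length; filter; concatMap; upTo)
open import Data.List.Membership.Propositional using (_∈_; lose)
open import Data.List.Membership.Propositional.Properties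
  using (∈-++⁺ˡ; ∈-++⁺ʳ; ∈-concatMap⁺; ∈-filter⁺; ∈-map⁻; ∈-upTo⁺)
open import Data.List.Properties
  using (concatMap-++; upTo-∷ʳ; ++-identityʳ; filter-++; filter-reject; length-filter; length-++)
open import Data.List.Relation.Unary.Any using (Any; here; there)
open import Data.List.Relation.Unary.Any.Properties using (any⁺)
open import Data.Nat using (zero; suc; pred; z≤n; s≤s; z<s; _⊔_; _⊓_; _≟_; >-nonZero)
open import Data.Nat.Properties
open import Data.Product using (_,_; proj₁; proj₂)
open import Data.Sum using (_⊎_; inj₁; inj₂)
import Data.Sum as Sum
open import Function.Base using (_∘_)
open import Function.Bundles using (Equivalence)
open import Algebra.Properties.CommutativeSemigroup +-commutativeSemigroup using (interchange; x∙yz≈y∙xz)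
open import Relation.Binary.PropositionalEquality
  using (_≢_; refl; sym; trans; cong; cong₂; subst; subst₂; module ≡-Reasoning)
open import Relation.Nullary using (Dec; yes; no; ¬_; contradiction)
open import Data.Nat.Tactic.RingSolver using (solve-∀)
import Data.List.Membership.DecPropositional as Membership
open import Data.Product.Properties using (≡-dec)
open import Relation.Nullary.Decidable using (fromWitness; toWitness; ¬?; _×-dec_)

private
  variable
    A B : Set
    a b c n m x y : ℕ
    f h : ℕ → ℕ
    F H : ℕ → ℕ → ℕ

sumBelow : ℕ → (ℕ → ℕ) → ℕ
sumBelow zero    f = 0
sumBelow (suc n) f = sumBelow n f + f n

syntax sumBelow n (λ x → e) = ∑[ x < n ] e

sumBelow-cong : ∀ n → (∀ x → f x ≡ h x) → sumBelow n f ≡ sumBelow n h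
sumBelow-cong zero    f≡h = refl
sumBelow-cong (suc n) f≡h = cong₂ _+_ (sumBelow-cong n f≡h) (f≡h n)

sumBelow-mono : ∀ n → (∀ {x} → x < n → f x ≤ h x) → sumBelow n f ≤ sumBelow n h
sumBelow-mono zero    f≤h = z≤n
sumBelow-mono (suc n) f≤h = +-mono-≤ (sumBelow-mono n (f≤h ∘ m<n⇒m<1+n)) (f≤h ≤-refl)

sumBelow-const : ∀ n → (∀ {x} → x < n → f x ≡ c) → sumBelow n f ≡ n * c
sumBelow-const zero            f≡c = refl
sumBelow-const {c = c} (suc n) f≡c =
  trans (cong₂ _+_ (sumBelow-const n (f≡c ∘ m<n⇒m<1+n)) (f≡c ≤-refl)) (+-comm (n * c) c)

sumBelow-zero : ∀ n → (∀ {x} → x < n → f x ≡ 0) → sumBelow n f ≡ 0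
sumBelow-zero n f≡0 = trans (sumBelow-const n f≡0) (*-zeroʳ n)

sumBelow-+ : ∀ n → sumBelow n (λ x → f x + h x) ≡ sumBelow n f + sumBelow n h
sumBelow-+ zero = refl
sumBelow-+ {f = f} {h = h} (suc n) =
  trans (cong (_+ (f n + h n)) (sumBelow-+ n)) (interchange (sumBelow n f) (sumBelow n h) (f n) (h n))

sumBelow-≥-term : ∀ n → x < n → f x ≤ sumBelow n f
sumBelow-≥-term {f = f} (suc n) x<1+n with m<1+n⇒m<n∨m≡n x<1+n
... | inj₁ x<n  = ≤-trans (sumBelow-≥-term n x<n) (m≤m+n (sumBelow n f) (f n))
... | inj₂ refl = m≤n+m (f n) (sumBelow n f)

sumBelow-≥-two : ∀ n → x < y → y < n → f x + f y ≤ sumBelow n f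
sumBelow-≥-two {y = y} {f = f} (suc n) x<y y<1+n with m<1+n⇒m<n∨m≡n y<1+n
... | inj₁ y<n  = ≤-trans (sumBelow-≥-two n x<y y<n) (m≤m+n (sumBelow n f) (f n))
... | inj₂ refl = +-monoˡ-≤ (f y) (sumBelow-≥-term n x<y)

sumBelow-≤-except : ∀ n → (∀ {x} → x < n → x ≢ a → f x ≤ h x) → (∀ {x} → x < n → f x ≤ c + h x) →
                    sumBelow n f ≤ c + sumBelow n h
sumBelow-≤-except zero _ _ = z≤n
sumBelow-≤-except {a} {f} {h} {c} (suc n) off all with n ≟ a
... | yes refl = begin
  sumBelow n f + f n        ≤⟨ +-mono-≤ (sumBelow-mono n (λ x<n → off (m<n⇒m<1+n x<n) (<⇒≢ x<n)))
                                        (all ≤-refl) ⟩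
  sumBelow n h + (c + h n)  ≡⟨ x∙yz≈y∙xz (sumBelow n h) c (h n) ⟩
  c + (sumBelow n h + h n)  ∎
  where open ≤-Reasoning
... | no n≢a = begin
  sumBelow n f + f n        ≤⟨ +-mono-≤ (sumBelow-≤-except n (off ∘ m<n⇒m<1+n) (all ∘ m<n⇒m<1+n))
                                        (off ≤-refl n≢a) ⟩
  (c + sumBelow n h) + h n  ≡⟨ +-assoc c (sumBelow n h) (h n) ⟩
  c + (sumBelow n h + h n)  ∎
  where open ≤-Reasoning

sumBelow-≤-single : ∀ n → (∀ {x} → x < n → x ≢ a → f x ≡ 0) → (∀ {x} → x < n → f x ≤ c) → sumBelow n f ≤ c
sumBelow-≤-single {f = f} {c} n off all = begin
  sumBelow n f               ≤⟨ sumBelow-≤-except {h = λ _ → 0} n (λ x<n x≢a → ≤-reflexive (off x<n x≢a))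
                                                                   (λ x<n → ≤-trans (all x<n) (m≤m+n c 0)) ⟩
  c + sumBelow n (λ _ → 0)   ≡⟨ cong (c +_) (sumBelow-zero n (λ _ → refl)) ⟩
  c + 0                      ≡⟨ +-identityʳ c ⟩
  c                          ∎
  where open ≤-Reasoning

sumBelow-positive : ∀ n → 0 < sumBelow n f → ∃ λ x → x < n × 0 < f x
sumBelow-positive {f} n 0<Σ with anyUpTo? (λ x → 0 <? f x) n
... | yes witness = witness
... | no none = contradiction (sumBelow-zero n vanish) (λ Σ≡0 → <-irrefl (sym Σ≡0) 0<Σ)
  where vanish : ∀ {x} → x < n → f x ≡ 0
        vanish x<n = n≤0⇒n≡0 (≮⇒≥ (λ 0<fx → none (_ , x<n , 0<fx)))

sumBelow-exceeds : ∀ n → (∀ {x} → x < n → f x ≤ c) → c < sumBelow n f → ∃ λ x → x < n × x ≢ a × 0 < f x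
sumBelow-exceeds {f} {c} {a} n all c<Σ with anyUpTo? (λ x → ¬? (x ≟ a) ×-dec (0 <? f x)) n
... | yes witness = witness
... | no none = contradiction (sumBelow-≤-single n vanish all) (<⇒≱ c<Σ)
  where vanish : ∀ {x} → x < n → x ≢ a → f x ≡ 0
        vanish x<n x≢a = n≤0⇒n≡0 (≮⇒≥ (λ 0<fx → none (_ , x<n , x≢a , 0<fx)))

sumBelow²-≤-except : ∀ n m → (∀ {i j} → i < n → j < m → (i , j) ≢ (a , b) → F i j ≤ H i j) →
                     (∀ {i j} → i < n → j < m → F i j ≤ c + H i j) →
                     ∑[ i < n ] sumBelow m (F i) ≤ c + ∑[ i < n ] sumBelow m (H i)
sumBelow²-≤-except n m off all =
  sumBelow-≤-except n (λ i<n i≢a → sumBelow-mono m (λ j<m → off i<n j<m (i≢a ∘ cong proj₁)))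
                      (λ i<n → sumBelow-≤-except m (λ j<m j≢b → off i<n j<m (j≢b ∘ cong proj₂)) (all i<n))

sumBelow²-≤-single : ∀ n m → (∀ {i j} → i < n → j < m → (i , j) ≢ (a , b) → F i j ≡ 0) →
                     (∀ {i j} → i < n → j < m → F i j ≤ c) →
                     ∑[ i < n ] sumBelow m (F i) ≤ c
sumBelow²-≤-single {F = F} {c} n m off all = begin
  ∑[ i < n ] sumBelow m (F i)    ≤⟨ sumBelow²-≤-except {H = λ _ _ → 0} n m
                                      (λ i<n j<m ≢ab → ≤-reflexive (off i<n j<m ≢ab))
                                      (λ i<n j<m → ≤-trans (all i<n j<m) (m≤m+n c 0)) ⟩
  c + ∑[ i < n ] ∑[ j < m ] 0    ≡⟨ cong (c +_) (sumBelow-zero n (λ _ → sumBelow-zero m (λ _ → refl))) ⟩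
  c + 0                          ≡⟨ +-identityʳ c ⟩
  c                              ∎
  where open ≤-Reasoning

sumBelow³-+ : ∀ n₁ n₂ n₃ {F₃ H₃ : ℕ → ℕ → ℕ → ℕ} →
  ∑[ i < n₁ ] ∑[ j < n₂ ] ∑[ t < n₃ ] (F₃ i j t + H₃ i j t)
    ≡ ∑[ i < n₁ ] ∑[ j < n₂ ] ∑[ t < n₃ ] F₃ i j t + ∑[ i < n₁ ] ∑[ j < n₂ ] ∑[ t < n₃ ] H₃ i j t
sumBelow³-+ n₁ n₂ n₃ =
  trans (sumBelow-cong n₁ λ i → trans (sumBelow-cong n₂ λ j → sumBelow-+ n₃) (sumBelow-+ n₂)) (sumBelow-+ n₁)

for³ : ℕ → ℕ → ℕ → (ℕ → ℕ → ℕ → List A) → List A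
for³ n₁ n₂ n₃ xs = concatMap (λ i → concatMap (λ j → concatMap (xs i j) (upTo n₃)) (upTo n₂)) (upTo n₁)

χ : Dec A → ℕ
χ (yes _) = 1
χ (no _)  = 0

χ≤1 : (a? : Dec A) → χ a? ≤ 1
χ≤1 (yes _) = ≤-refl
χ≤1 (no _)  = z≤n

χ-yes : (a? : Dec A) → A → χ a? ≡ 1
χ-yes (yes _) _  = refl
χ-yes (no ¬a) a  = contradiction a ¬a

χ-mono : (A → B) → (a? : Dec A) (b? : Dec B) → χ a? ≤ χ b?
χ-mono _   (no _)  _       = z≤n
χ-mono _   (yes _) (yes _) = ≤-refl
χ-mono A→B (yes a) (no ¬b) = contradiction (A→B a) ¬b

χ-positive : (a? : Dec A) → 0 < χ a? → A
χ-positive (yes a) _ = a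

∈-concatMap-upTo : ∀ {i} {xs : ℕ → List A} {z} → i < n → z ∈ xs i → z ∈ concatMap xs (upTo n)
∈-concatMap-upTo {xs = xs} i<n z∈ = ∈-concatMap⁺ xs (lose (∈-upTo⁺ i<n) z∈)

≤-max : ∀ {xs : List A} {z} (φ : A → ℕ) → z ∈ xs → φ z ≤ foldr _⊔_ 0 (map φ xs)
≤-max φ (here refl)          = m≤m⊔n _ _
≤-max φ (there {x = z'} z∈) = ≤-trans (≤-max φ z∈) (m≤n⊔m (φ z') _)

max-≤ : ∀ (φ : A → ℕ) (xs : List A) → (∀ z → φ z ≤ c) → foldr _⊔_ 0 (map φ xs) ≤ c
max-≤ φ []       _     = z≤n
max-≤ φ (z ∷ zs) φ≤c = ⊔-lub (φ≤c z) (max-≤ φ zs φ≤c)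

≤-min : ∀ (φ : A → ℕ) {z} (zs : List A) → c ≤ φ z → (∀ {z'} → z' ∈ zs → c ≤ φ z') →
        c ≤ foldr _⊓_ (φ z) (map φ zs)
≤-min φ []        c≤ _    = c≤
≤-min φ (z' ∷ zs) c≤ c≤zs = ⊓-glb (c≤zs (here refl)) (≤-min φ zs c≤ (c≤zs ∘ there))

module Additive {A : Set} (μ : List A → ℕ) (μ-[] : μ [] ≡ 0)
                (μ-++ : ∀ xs ys → μ (xs ++ ys) ≡ μ xs + μ ys) where

  μ-concatMap-upTo : ∀ n (xs : ℕ → List A) → μ (concatMap xs (upTo n)) ≡ ∑[ x < n ] μ (xs x)
  μ-concatMap-upTo zero    xs = μ-[]
  μ-concatMap-upTo (suc n) xs = begin
    μ (concatMap xs (upTo (suc n)))                 ≡⟨ cong (μ ∘ concatMap xs) (upTo-∷ʳ n) ⟨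
    μ (concatMap xs (upTo n ++ [ n ]))              ≡⟨ cong μ (concatMap-++ xs (upTo n) [ n ]) ⟩
    μ (concatMap xs (upTo n) ++ (xs n ++ []))       ≡⟨ μ-++ _ _ ⟩
    μ (concatMap xs (upTo n)) + μ (xs n ++ [])      ≡⟨ cong₂ _+_ (μ-concatMap-upTo n xs)
                                                                 (cong μ (++-identityʳ (xs n))) ⟩
    ∑[ x < n ] μ (xs x) + μ (xs n)                  ∎
    where open ≡-Reasoning

  μ-for³ : ∀ n₁ n₂ n₃ (xs : ℕ → ℕ → ℕ → List A) →
           μ (for³ n₁ n₂ n₃ xs) ≡ ∑[ i < n₁ ] ∑[ j < n₂ ] ∑[ t < n₃ ] μ (xs i j t)
  μ-for³ n₁ n₂ n₃ xs =
    trans (μ-concatMap-upTo n₁ _) (sumBelow-cong n₁ λ i →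
      trans (μ-concatMap-upTo n₂ _) (sumBelow-cong n₂ λ j → μ-concatMap-upTo n₃ (xs i j)))

∈-for³ : ∀ {n₁ n₂ n₃ i j t} {xs : ℕ → ℕ → ℕ → List A} {z} →
         i < n₁ → j < n₂ → t < n₃ → z ∈ xs i j t → z ∈ for³ n₁ n₂ n₃ xs
∈-for³ {xs = xs} i< j< t< z∈ =
  ∈-concatMap-upTo i< (∈-concatMap-upTo j< (∈-concatMap-upTo {xs = xs _ _} t< z∈))

length-concatMap-upTo : ∀ n {xs : ℕ → List A} → (∀ x → length (xs x) ≡ c) →
                        length (concatMap xs (upTo n)) ≡ n * c
length-concatMap-upTo n {xs} len≡c =
  trans (μ-concatMap-upTo n xs) (sumBelow-const n (λ {x} _ → len≡c x))
  where open Additive length refl (λ xs ys → length-++ xs)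

length-for³ : ∀ n₁ n₂ n₃ {xs : ℕ → ℕ → ℕ → List A} → (∀ i j t → length (xs i j t) ≡ c) →
              length (for³ n₁ n₂ n₃ xs) ≡ n₁ * (n₂ * (n₃ * c))
length-for³ n₁ n₂ n₃ len≡c =
  length-concatMap-upTo n₁ λ i → length-concatMap-upTo n₂ λ j → length-concatMap-upTo n₃ λ t → len≡c i j t

≤-else : ∀ {t : Bool} {u v} → t ≡ false → m ≤ v → m ≤ (if t then u else v)
≤-else refl m≤v = m≤v

∈-if-true : ∀ {t : Bool} {z : A} → t ≡ true → z ∈ (if t then z ∷ [] else [])
∈-if-true refl = here refl

module GameProperties (G : Graph) where
  open Graph G
  open Game G

  private
    variable
      E E′ : List Edge
      u v w : V

  Adjacent : List Edge → V → V → Set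
  Adjacent E u w = (u , w) ∈ E ⊎ (w , u) ∈ E

  infixr 5 _◅_ _◅◅_

  data Walk (E : List Edge) : V → V → ℕ → Set where
    ε   : Walk E u u 0
    _◅_ : Adjacent E u v → Walk E v w n → Walk E u w (suc n)

  _◅◅_ : Walk E u v m → Walk E v w n → Walk E u w (m + n)
  ε       ◅◅ q = q
  (s ◅ p) ◅◅ q = s ◅ (p ◅◅ q)

  reverse : Walk E u v n → Walk E v u n
  reverse ε                   = ε
  reverse {n = suc n} (s ◅ p) = subst (Walk _ _ _) (+-comm n 1) (reverse p ◅◅ Sum.swap s ◅ ε)

  ==-refl : T (u == u)
  ==-refl {u} = fromWitness {a? = u ≟V u} refl

  Adjacent-nonisolated : Adjacent E u w → isolated E u ≡ false
  Adjacent-nonisolated {E} {u} adj = cong not (Equivalence.to T-≡ (any⁺ (incident u) (hit adj)))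
    where
    hit : Adjacent E u w → Any (T ∘ incident u) E
    hit (inj₁ uw∈) = lose uw∈ (Equivalence.from T-∨ (inj₁ ==-refl))
    hit (inj₂ wu∈) = lose wu∈ (Equivalence.from T-∨ (inj₂ ==-refl))

  Walk-nonisolated : Walk E u w n → u ≢ w → isolated E u ≡ false
  Walk-nonisolated ε       u≢u = contradiction refl u≢u
  Walk-nonisolated (s ◅ _) _   = Adjacent-nonisolated s

  elem-∈ : ∀ {Us} → u ∈ Us → elem u Us ≡ true
  elem-∈ u∈ = Equivalence.to T-≡ (any⁺ _ (lose u∈ ==-refl))

  step-Adjacent : ∀ {Us} → u ∈ Us → Adjacent E u w → w ∈ step E Us
  step-Adjacent {Us = Us} u∈ (inj₁ uw∈) =
    ∈-++⁺ʳ Us (∈-concatMap⁺ _ (lose uw∈ (∈-++⁺ˡ (∈-if-true (elem-∈ u∈)))))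
  step-Adjacent {Us = Us} u∈ (inj₂ wu∈) =
    ∈-++⁺ʳ Us (∈-concatMap⁺ _ (lose wu∈ (∈-++⁺ʳ _ (∈-if-true (elem-∈ u∈)))))

  module _ (next : ℕ → List V → List V)
           (next-zero : ∀ Us → next 0 Us ≡ Us)
           (next-suc : ∀ m Us → next (suc m) Us ≡ next m (step E Us)) where

    iterated-step-⊇ : ∀ m {Us} → u ∈ Us → u ∈ next m Us
    iterated-step-⊇ zero    {Us} u∈ = subst (_ ∈_) (sym (next-zero Us)) u∈
    iterated-step-⊇ (suc m) {Us} u∈ = subst (_ ∈_) (sym (next-suc m Us)) (iterated-step-⊇ m (∈-++⁺ˡ u∈))

    iterated-step-complete : ∀ m {Us} → u ∈ Us → Walk E u w n → n ≤ m → w ∈ next m Us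
    iterated-step-complete m u∈ ε _ = iterated-step-⊇ m u∈
    iterated-step-complete (suc m) {Us} u∈ (s ◅ p) (s≤s n≤m) =
      subst (_ ∈_) (sym (next-suc m Us)) (iterated-step-complete m (step-Adjacent u∈ s) p n≤m)

  -- reach iterates a local function that cannot be named; abstracting its arguments lets
  -- unification recover it as next.
  reach-complete : Walk E v w n → n ≤ length E → w ∈ reach E v
  reach-complete {E} {v} {n = n} p n≤
    with iterated-step-complete {E} _ (λ _ → refl) (λ _ _ → refl) | length E in len≡ | v ∷ [] in [v]≡
  ... | complete | len | Us = complete len (subst (v ∈_) [v]≡ (here refl)) p (subst (n ≤_) len≡ n≤)

  catMoves-complete : Walk E v w n → n ≤ length E → w ≢ v → w ∈ catMoves E v
  catMoves-complete p n≤ w≢v = ∈-filter⁺ _ (reach-complete p n≤) w≢v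

  record Cut (E E′ : List Edge) : Set where
    field
      edge     : Edge
      keeps    : ∀ {e} → e ∈ E → e ≢ edge → e ∈ E′
      shortens : length E ≡ suc (length E′)

  removals-Cut : E′ ∈ removals E → Cut E E′
  removals-Cut {E = e ∷ es} (here refl) = record { edge = e ; keeps = keeps ; shortens = refl }
    where
    keeps : ∀ {x} → x ∈ e ∷ es → x ≢ e → x ∈ es
    keeps (here x≡e) x≢e = contradiction x≡e x≢e
    keeps (there x∈) _   = x∈
  removals-Cut {E = e ∷ es} (there E′∈) with ∈-map⁻ (e ∷_) E′∈
  ... | E″ , E″∈ , refl = record { edge = edge ; keeps = keeps′ ; shortens = cong suc shortens }
    where
    open Cut (removals-Cut E″∈)
    keeps′ : ∀ {x} → x ∈ e ∷ es → x ≢ edge → x ∈ e ∷ E″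
    keeps′ (here x≡e) _   = here x≡e
    keeps′ (there x∈) x≢ = there (keeps x∈ x≢)

  catValue : ℕ → List Edge → V → ℕ
  catValue f E v = if isolated E v then 0 else maxList (map (herderVal f E) (catMoves E v))

  herderVal-≥ : isolated E v ≡ false → (∀ {E′} → Cut E E′ → m ≤ catValue (length E′) E′ v) →
                suc m ≤ herderVal (length E) E v
  herderVal-≥ {E = e ∷ es} {v} {m} iso cat≥ =
    ≤-else iso (≤-min (λ E′ → suc (catValue (length es) E′ v)) {es} (map (e ∷_) (removals es))
                      (s≤s (after (here refl))) (s≤s ∘ after ∘ there))
    where
    after : E′ ∈ removals (e ∷ es) → m ≤ catValue (length es) E′ v
    after {E′} E′∈ = subst (λ f → m ≤ catValue f E′ v) (sym (suc-injective shortens)) (cat≥ cut)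
      where cut = removals-Cut E′∈
            open Cut cut

  catValue-≥ : ∀ {f} → Walk E v w n → n ≤ length E → w ≢ v → m ≤ herderVal f E w → m ≤ catValue f E v
  catValue-≥ {E = E} {f = f} p n≤ w≢v m≤ =
    ≤-else (Walk-nonisolated p (w≢v ∘ sym)) (≤-trans m≤ (≤-max (herderVal f E) (catMoves-complete p n≤ w≢v)))

  herderVal-positive : isolated E v ≡ false → 1 ≤ herderVal (length E) E v
  herderVal-positive {E} {v} iso = herderVal-≥ {E} {v} iso (λ _ → z≤n)

  degree-++ : ∀ xs ys → degree (xs ++ ys) v ≡ degree xs v + degree ys v
  degree-++ xs ys = trans (cong length (filter-++ _ xs ys)) (length-++ (filter _ xs))

  degree-≤-length : ∀ xs → degree xs v ≤ length xs
  degree-≤-length xs = length-filter _ xs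

  degree-≡0 : u ≢ v → w ≢ v → degree ((u , w) ∷ []) v ≡ 0
  degree-≡0 {u} {v} {w} u≢v w≢v =
    cong length (filter-reject (λ e → incident v e Bool.≟ true) {xs = []} (Sum.[ u≢v , w≢v ] ∘ endpoint))
    where
    endpoint : incident v (u , w) ≡ true → u ≡ v ⊎ w ≡ v
    endpoint inc = Sum.map (toWitness {a? = u ≟V v}) (toWitness {a? = w ≟V v})
                           (Equivalence.to T-∨ (Equivalence.from T-≡ inc))

  degree-≤-by-key : ∀ n₁ n₂ n₃ (key : V → ℕ × ℕ) (e : ℕ → ℕ → ℕ → Edge) →
    (∀ i j t → key (proj₁ (e i j t)) ≡ (i , j) × key (proj₂ (e i j t)) ≡ (i , j)) →
    ∑[ i < n₁ ] ∑[ j < n₂ ] ∑[ t < n₃ ] degree (e i j t ∷ []) v ≤ n₃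
  degree-≤-by-key {v} n₁ n₂ n₃ key e keys = sumBelow²-≤-single {proj₁ (key v)} {proj₂ (key v)} n₁ n₂
    (λ {i} {j} _ _ ij≢ → sumBelow-zero n₃ λ {t} _ →
       degree-≡0 (λ x≡v → ij≢ (trans (sym (proj₁ (keys i j t))) (cong key x≡v)))
                 (λ y≡v → ij≢ (trans (sym (proj₂ (keys i j t))) (cong key y≡v))))
    (λ {i} {j} _ _ → ≤-trans (sumBelow-mono n₃ (λ {t} _ → degree-≤-length {v = v} (e i j t ∷ [])))
                             (≤-reflexive (trans (sumBelow-const n₃ (λ _ → refl)) (*-identityʳ n₃))))

  degree-pairs-≤ : ∀ n₁ n₂ n₃ (key₁ key₂ : V → ℕ × ℕ) (e₁ e₂ : ℕ → ℕ → ℕ → Edge) →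
    (∀ i j t → key₁ (proj₁ (e₁ i j t)) ≡ (i , j) × key₁ (proj₂ (e₁ i j t)) ≡ (i , j)) →
    (∀ i j t → key₂ (proj₁ (e₂ i j t)) ≡ (i , j) × key₂ (proj₂ (e₂ i j t)) ≡ (i , j)) →
    ∑[ i < n₁ ] ∑[ j < n₂ ] ∑[ t < n₃ ] degree (e₁ i j t ∷ e₂ i j t ∷ []) v ≤ n₃ + n₃
  degree-pairs-≤ {v} n₁ n₂ n₃ key₁ key₂ e₁ e₂ keys₁ keys₂ = begin
    ∑[ i < n₁ ] ∑[ j < n₂ ] ∑[ t < n₃ ] degree (e₁ i j t ∷ e₂ i j t ∷ []) v
      ≡⟨ sumBelow-cong n₁ (λ i → sumBelow-cong n₂ λ j → sumBelow-cong n₃ λ t →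
           degree-++ (e₁ i j t ∷ []) (e₂ i j t ∷ [])) ⟩
    ∑[ i < n₁ ] ∑[ j < n₂ ] ∑[ t < n₃ ] (degree (e₁ i j t ∷ []) v + degree (e₂ i j t ∷ []) v)
      ≡⟨ sumBelow³-+ n₁ n₂ n₃ ⟩
    ∑[ i < n₁ ] ∑[ j < n₂ ] ∑[ t < n₃ ] degree (e₁ i j t ∷ []) v
      + ∑[ i < n₁ ] ∑[ j < n₂ ] ∑[ t < n₃ ] degree (e₂ i j t ∷ []) v
      ≤⟨ +-mono-≤ (degree-≤-by-key n₁ n₂ n₃ key₁ e₁ keys₁) (degree-≤-by-key n₁ n₂ n₃ key₂ e₂ keys₂) ⟩
    n₃ + n₃ ∎
    where open ≤-Reasoning

data Direction : Set where
  horizontal vertical : Direction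

turn : Direction → Direction
turn horizontal = vertical
turn vertical   = horizontal

turn-≢ : ∀ d → turn d ≢ d
turn-≢ horizontal ()
turn-≢ vertical   ()

budget-identity : ∀ a b → let P = suc a; k = suc b in
  P * 4 + suc (P * k) + (2 + 7 * a + 4 * (a * a) + 7 * b + 11 * (a * b) + 4 * (a * a * b))
    ≡ suc P * (P * (k * 2)) + P * (suc P * (k * 2))
budget-identity = solve-∀

initial-budget : ∀ P k → 1 ≤ P → 1 ≤ k → P * 4 + suc (P * k) ≤ suc P * (P * (k * 2)) + P * (suc P * (k * 2))
initial-budget (suc a) (suc b) _ _ = ≤-trans (m≤m+n _ _) (≤-reflexive (budget-identity a b))

vertex-count-identity : ∀ P k →
  suc P * (suc P * 1) + (suc P * (P * (k * 1)) + P * (suc P * (k * 1))) ≡ suc P * suc P + 2 * k * suc P * P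
vertex-count-identity = solve-∀

cat-square-identity : ∀ q l → let P = 2 + q; k = suc l in
  4 * k * (suc P * suc P + 2 * k * suc P * P) + (4 * k * (l * P * q + 2 * q + 3) + 12)
    ≡ 12 * (suc (P * k) * suc (P * k))
cat-square-identity = solve-∀

cat-square-bound : ∀ P k → 2 ≤ P →
                   4 * k * (suc P * suc P + 2 * k * suc P * P) ≤ 12 * (suc (P * k) * suc (P * k))
cat-square-bound (suc (suc q)) zero    (s≤s (s≤s z≤n)) = z≤n
cat-square-bound (suc (suc q)) (suc l) (s≤s (s≤s z≤n)) =
  ≤-trans (m≤m+n _ _) (≤-reflexive (cat-square-identity q l))

four-copies : ∀ k → (k + k) + (k + k) ≡ 4 * k
four-copies = solve-∀

-- Gr p k with p = suc P, so that the p ∸ 1 in grEdges reduces to P.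
module Grid (P k : ℕ) where

  p : ℕ
  p = suc P

  G : Graph
  G = Gr p k

  open Game G
  open GameProperties G

  private
    variable
      E E′ : List Edge
      d : Direction
      t s : ℕ

  node : Direction → ℕ → ℕ → GrV
  node horizontal a x = g a x
  node vertical   a x = g x a

  mid : Direction → ℕ → ℕ → ℕ → GrV
  mid horizontal a t x = hm a x t
  mid vertical   a t x = vm x a t

  node-turn : ∀ d a b → node (turn d) b a ≡ node d a b
  node-turn horizontal a b = refl
  node-turn vertical   a b = refl

  node-injective : ∀ d {a x y} → node d a x ≡ node d a y → x ≡ y
  node-injective horizontal refl = refl
  node-injective vertical   refl = refl

  Intact : List Edge → Direction → ℕ → ℕ → Set
  Intact E d a t = ∀ {x} → x < P → (node d a x , mid d a t x) ∈ E × (mid d a t x , node d a (suc x)) ∈ E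

  intact? : ∀ E d a t → Dec (Intact E d a t)
  intact? E d a t =
    allUpTo? (λ x → ((node d a x , mid d a t x) ∈? E) ×-dec ((mid d a t x , node d a (suc x)) ∈? E)) P
    where open Membership (≡-dec _≟GrV_ _≟GrV_) using (_∈?_)

  intactLines : List Edge → Direction → ℕ
  intactLines E d = ∑[ a < p ] ∑[ t < k ] χ (intact? E d a t)

  lineOf : Edge → Direction × ℕ × ℕ
  lineOf (_ , hm a _ t) = horizontal , a , t
  lineOf (hm a _ t , _) = horizontal , a , t
  lineOf (_ , vm _ a t) = vertical , a , t
  lineOf (vm _ a t , _) = vertical , a , t
  lineOf _              = horizontal , 0 , 0   -- junk: no edge of Gr has this shape

  lineOf-line : ∀ d a t x → lineOf (node d a x , mid d a t x) ≡ (d , a , t)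
                          × lineOf (mid d a t x , node d a (suc x)) ≡ (d , a , t)
  lineOf-line horizontal a t x = refl , refl
  lineOf-line vertical   a t x = refl , refl

  Intact-Cut : ∀ {a} (cut : Cut E E′) → lineOf (Cut.edge cut) ≢ (d , a , t) → Intact E d a t → Intact E′ d a t
  Intact-Cut {d = d} {t} {a} cut off line {x} x<P =
    keeps (proj₁ (line x<P)) (λ e≡ → off (trans (cong lineOf (sym e≡)) (proj₁ (lineOf-line d a t x)))) ,
    keeps (proj₂ (line x<P)) (λ e≡ → off (trans (cong lineOf (sym e≡)) (proj₂ (lineOf-line d a t x))))
    where open Cut cut

  crossing-line-survives : ∀ {a b} → Cut E E′ → Intact E d a t → Intact E (turn d) b s →
                           ¬ Intact E′ d a t → Intact E′ (turn d) b s
  crossing-line-survives {d = d} cut along across broken = Intact-Cut cut off across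
    where
    off : lineOf (Cut.edge cut) ≢ (turn d , _ , _)
    off e∈across = broken (Intact-Cut cut (λ e∈along → turn-≢ d (cong proj₁ (trans (sym e∈across) e∈along)))
                                      along)

  intactLines-Cut : Cut E E′ → intactLines E d ≤ suc (intactLines E′ d)
  intactLines-Cut {E} {E′} {d} cut =
    sumBelow²-≤-except {proj₁ (proj₂ cutLine)} {proj₂ (proj₂ cutLine)} {c = 1} p k
      (λ _ _ at≢ → χ-mono (Intact-Cut cut (at≢ ∘ sym ∘ cong proj₂)) (intact? E d _ _) (intact? E′ d _ _))
      (λ _ _ → ≤-trans (χ≤1 (intact? E d _ _)) (m≤m+n 1 _))
    where cutLine = lineOf (Cut.edge cut)

  intactLines-at-≤ : ∀ E d a → ∑[ t < k ] χ (intact? E d a t) ≤ k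
  intactLines-at-≤ E d a =
    ≤-trans (sumBelow-mono k (λ {t} _ → χ≤1 (intact? E d a t)))
            (≤-reflexive (trans (sumBelow-const k (λ _ → refl)) (*-identityʳ k)))

  another-intact-line : ∀ b → k < intactLines E d → ∃ λ b′ → b′ < p × b′ ≢ b × ∃ λ t → Intact E d b′ t
  another-intact-line {E} {d} b k< with sumBelow-exceeds {a = b} p (λ {a} _ → intactLines-at-≤ E d a) k<
  ... | b′ , b′<p , b′≢b , 0<Σ with sumBelow-positive k 0<Σ
  ...   | t , _ , 0<χ = b′ , b′<p , b′≢b , t , χ-positive (intact? E d b′ t) 0<χ

  walk-to-start : ∀ {a} → Intact E d a t → ∀ {x} → x ≤ P → Walk E (node d a x) (node d a 0) (x * 2)
  walk-to-start line {zero}  _     = ε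
  walk-to-start line {suc x} x<P =
    inj₂ (proj₂ (line x<P)) ◅ inj₂ (proj₁ (line x<P)) ◅ walk-to-start line (<⇒≤ x<P)

  walk-along : ∀ {a x y} → Intact E d a t → x ≤ P → y ≤ P → Walk E (node d a x) (node d a y) (x * 2 + y * 2)
  walk-along line x≤P y≤P = walk-to-start line x≤P ◅◅ reverse (walk-to-start line y≤P)

  walk-along-length : ∀ {x y} → x ≤ P → y ≤ P → x * 2 + y * 2 ≤ P * 4
  walk-along-length x≤P y≤P =
    ≤-trans (+-mono-≤ (*-monoˡ-≤ 2 x≤P) (*-monoˡ-≤ 2 y≤P)) (≤-reflexive (sym (*-distribˡ-+ P 2 2)))

  catValue-≥-along : ∀ {a b b′ m} → Intact E′ d a t → b < p → b′ < p → b′ ≢ b → P * 4 ≤ length E′ →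
                     m ≤ herderVal (length E′) E′ (node d a b′) → m ≤ catValue (length E′) E′ (node d a b)
  catValue-≥-along {E′ = E′} {d = d} line b<p b′<p b′≢b budget =
    catValue-≥ {f = length E′} (walk-along line (≤-pred b<p) (≤-pred b′<p))
               (≤-trans (walk-along-length (≤-pred b<p) (≤-pred b′<p)) budget)
               (b′≢b ∘ node-injective d)

  horizontalPair verticalPair : ℕ → ℕ → ℕ → List Edge
  horizontalPair i j t = (g i j , hm i j t) ∷ (hm i j t , g i (suc j)) ∷ []
  verticalPair   i j t = (g i j , vm i j t) ∷ (vm i j t , g (suc i) j) ∷ []

  allEdges : List Edge
  allEdges = for³ p P k horizontalPair ++ for³ P p k verticalPair

  allEdges-intact : ∀ d {a t} → a < p → t < k → Intact allEdges d a t
  allEdges-intact horizontal a<p t<k x<P =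
    ∈-++⁺ˡ (∈-for³ {xs = horizontalPair} a<p x<P t<k (here refl)) ,
    ∈-++⁺ˡ (∈-for³ {xs = horizontalPair} a<p x<P t<k (there (here refl)))
  allEdges-intact vertical   a<p t<k x<P =
    ∈-++⁺ʳ (for³ p P k horizontalPair) (∈-for³ {xs = verticalPair} x<P a<p t<k (here refl)) ,
    ∈-++⁺ʳ (for³ p P k horizontalPair) (∈-for³ {xs = verticalPair} x<P a<p t<k (there (here refl)))

  intactLines-allEdges : ∀ d → intactLines allEdges d ≡ p * k
  intactLines-allEdges d = sumBelow-const p λ a<p →
    trans (sumBelow-const k λ t<k → χ-yes (intact? allEdges d _ _) (allEdges-intact d a<p t<k))
          (*-identityʳ k)

  length-allEdges : length allEdges ≡ p * (P * (k * 2)) + P * (p * (k * 2))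
  length-allEdges = trans (length-++ (for³ p P k horizontalPair))
                        (cong₂ _+_ (length-for³ p P k (λ _ _ _ → refl)) (length-for³ P p k (λ _ _ _ → refl)))

  degree-allEdges : ∀ v → degree allEdges v ≡ ∑[ i < p ] ∑[ j < P ] ∑[ t < k ] degree (horizontalPair i j t) v
                                         + ∑[ i < P ] ∑[ j < p ] ∑[ t < k ] degree (verticalPair i j t) v
  degree-allEdges v = trans (degree-++ (for³ p P k horizontalPair) _)
                          (cong₂ _+_ (μ-for³ p P k horizontalPair) (μ-for³ P p k verticalPair))
    where open Additive (λ E → degree E v) refl degree-++

  -- source v is the grid vertex (i , j) from which a path through v starts; sourceʰ and sourceᵛ
  -- read a grid vertex instead as the far end of a horizontal or vertical path.
  source sourceʰ sourceᵛ : GrV → ℕ × ℕ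
  source (g a b)    = a , b
  source (hm a b _) = a , b
  source (vm a b _) = a , b
  sourceʰ (g a b) = a , pred b
  sourceʰ v       = source v
  sourceᵛ (g a b) = pred a , b
  sourceᵛ v       = source v

  degree-≤ : ∀ v → degree allEdges v ≤ 4 * k
  degree-≤ v = begin
    degree allEdges v
      ≡⟨ degree-allEdges v ⟩
    ∑[ i < p ] ∑[ j < P ] ∑[ t < k ] degree (horizontalPair i j t) v
      + ∑[ i < P ] ∑[ j < p ] ∑[ t < k ] degree (verticalPair i j t) v
      ≤⟨ +-mono-≤ (degree-pairs-≤ {v = v} p P k source sourceʰ
                     (λ i j t → g i j , hm i j t) (λ i j t → hm i j t , g i (suc j))
                     (λ _ _ _ → refl , refl) (λ _ _ _ → refl , refl))
                  (degree-pairs-≤ {v = v} P p k source sourceᵛ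
                     (λ i j t → g i j , vm i j t) (λ i j t → vm i j t , g (suc i) j)
                     (λ _ _ _ → refl , refl) (λ _ _ _ → refl , refl)) ⟩
    (k + k) + (k + k)
      ≡⟨ four-copies k ⟩
    4 * k ∎
    where open ≤-Reasoning

  degree-interior-≥ : 2 ≤ P → 4 * k ≤ degree allEdges (g 1 1)
  degree-interior-≥ 2≤P = begin
    4 * k
      ≡⟨ four-copies k ⟨
    (k + k) + (k + k)
      ≡⟨ cong₂ _+_ (cong₂ _+_ (all-incident (horizontalPair 1 0) (λ _ → refl))
                              (all-incident (horizontalPair 1 1) (λ _ → refl)))
                   (cong₂ _+_ (all-incident (verticalPair 0 1) (λ _ → refl))
                              (all-incident (verticalPair 1 1) (λ _ → refl))) ⟨
    (∑[ t < k ] degree (horizontalPair 1 0 t) (g 1 1) + ∑[ t < k ] degree (horizontalPair 1 1 t) (g 1 1))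
      + (∑[ t < k ] degree (verticalPair 0 1 t) (g 1 1) + ∑[ t < k ] degree (verticalPair 1 1 t) (g 1 1))
      ≤⟨ +-mono-≤ (≤-trans (sumBelow-≥-two P z<s 2≤P) (sumBelow-≥-term p 1<p))
                  (≤-trans (+-mono-≤ (sumBelow-≥-term p 1<p) (sumBelow-≥-term p 1<p))
                           (sumBelow-≥-two P z<s 2≤P)) ⟩
    ∑[ i < p ] ∑[ j < P ] ∑[ t < k ] degree (horizontalPair i j t) (g 1 1)
      + ∑[ i < P ] ∑[ j < p ] ∑[ t < k ] degree (verticalPair i j t) (g 1 1)
      ≡⟨ degree-allEdges (g 1 1) ⟨
    degree allEdges (g 1 1) ∎
    where
    open ≤-Reasoning
    1<p : 1 < p
    1<p = s≤s (<⇒≤ 2≤P)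
    all-incident : ∀ (pair : ℕ → List Edge) → (∀ t → degree (pair t) (g 1 1) ≡ 1) →
                   ∑[ t < k ] degree (pair t) (g 1 1) ≡ k
    all-incident pair incident = trans (sumBelow-const k (λ {t} _ → incident t)) (*-identityʳ k)

  Δ-Gr : 2 ≤ P → Δ G ≡ 4 * k
  Δ-Gr 2≤P = ≤-antisym (max-≤ (degree allEdges) (grVertices p k) degree-≤)
                       (≤-trans (degree-interior-≥ 2≤P) (≤-max (degree allEdges) g11∈))
    where
    1<p : 1 < p
    1<p = s≤s (<⇒≤ 2≤P)
    g11∈ : g 1 1 ∈ grVertices p k
    g11∈ = ∈-++⁺ˡ (∈-concatMap-upTo {xs = λ i → concatMap (λ j → g i j ∷ []) (upTo p)} 1<p
                    (∈-concatMap-upTo {xs = λ j → g 1 j ∷ []} 1<p (here refl)))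

  ∣V∣-Gr : ∣V∣ G ≡ p * p + 2 * k * p * P
  ∣V∣-Gr = begin
    length (grids ++ horizontalMids ++ verticalMids)
      ≡⟨ length-++ grids ⟩
    length grids + length (horizontalMids ++ verticalMids)
      ≡⟨ cong (length grids +_) (length-++ horizontalMids) ⟩
    length grids + (length horizontalMids + length verticalMids)
      ≡⟨ cong₂ _+_ (length-concatMap-upTo p {xs = gridRow}
                      (λ i → length-concatMap-upTo p {xs = λ j → g i j ∷ []} λ _ → refl))
                   (cong₂ _+_ (length-for³ p P k {xs = λ i j t → hm i j t ∷ []} (λ _ _ _ → refl))
                              (length-for³ P p k {xs = λ i j t → vm i j t ∷ []} (λ _ _ _ → refl))) ⟩
    p * (p * 1) + (p * (P * (k * 1)) + P * (p * (k * 1)))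
      ≡⟨ vertex-count-identity P k ⟩
    p * p + 2 * k * p * P ∎
    where
    open ≡-Reasoning
    gridRow : ℕ → List GrV
    gridRow i = concatMap (λ j → g i j ∷ []) (upTo p)
    grids horizontalMids verticalMids : List GrV
    grids          = concatMap gridRow (upTo p)
    horizontalMids = for³ p P k (λ i j t → hm i j t ∷ [])
    verticalMids   = for³ P p k (λ i j t → vm i j t ∷ [])

  module CatStrategy (1≤P : 1 ≤ P) where

    other : ℕ → ℕ
    other zero    = 1
    other (suc _) = 0

    other<p : ∀ b → other b < p
    other<p zero    = s≤s 1≤P
    other<p (suc _) = s≤s z≤n

    other≢ : ∀ b → other b ≢ b
    other≢ zero    ()
    other≢ (suc _) ()

    record CatPosition (m : ℕ) (E : List Edge) (d : Direction) (a b : ℕ) : Set where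
      field
        a<p    : a < p
        b<p    : b < p
        along  : ∃ (Intact E d a)
        across : ∃ (Intact E (turn d) b)
        enough : ∀ d′ → k + m ≤ suc (intactLines E d′)
        -- reach only follows walks of at most length E steps; walks along a line need P * 4
        budget : P * 4 + m ≤ length E

    CatPosition-turn : ∀ {m a b} → CatPosition m E d a b → CatPosition m E (turn d) b a
    CatPosition-turn {d = horizontal} pos = record { a<p = b<p ; b<p = a<p ; along = across ; across = along
                                                   ; enough = enough ; budget = budget }
      where open CatPosition pos
    CatPosition-turn {d = vertical}   pos = record { a<p = b<p ; b<p = a<p ; along = across ; across = along
                                                   ; enough = enough ; budget = budget }
      where open CatPosition pos

    CatPosition-nonisolated : ∀ {m a b} → CatPosition m E d a b → isolated E (node d a b) ≡ false
    CatPosition-nonisolated {d = d} {b = b} pos =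
      Walk-nonisolated (walk-along (proj₂ along) (≤-pred b<p) (≤-pred (other<p b)))
                       (other≢ b ∘ sym ∘ node-injective d)
      where open CatPosition pos

    after-cut : ∀ {m a b} → CatPosition (suc m) E d a b → Cut E E′ →
                (∀ d′ → k + m ≤ suc (intactLines E′ d′)) × (P * 4 + m ≤ length E′)
    after-cut {E} {m = m} pos cut =
      (λ d′ → ≤-trans (≤-pred (subst (_≤ suc (intactLines E d′)) (+-suc k m) (enough d′)))
                      (intactLines-Cut cut)) ,
      ≤-pred (subst₂ _≤_ (+-suc (P * 4) m) shortens budget)
      where open CatPosition pos
            open Cut cut

    Survives : ℕ → Set
    Survives m = ∀ {E d a b} → CatPosition m E d a b → m ≤ herderVal (length E) E (node d a b)

    next-position : ∀ {m a b} → CatPosition (suc (suc (suc m))) E d a b → Cut E E′ → Intact E′ d a t →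
                    ∃ λ b′ → b′ < p × b′ ≢ b × CatPosition (suc (suc m)) E′ d a b′
    next-position {d = d} {t = t} {m} {b = b} pos cut line =
      let b′ , b′<p , b′≢b , across′ = another-intact-line b (k<intactLines (enough′ (turn d)))
      in b′ , b′<p , b′≢b , record { a<p = a<p ; b<p = b′<p ; along = t , line ; across = across′
                                   ; enough = enough′ ; budget = budget′ }
      where
      open CatPosition pos
      enough′ = proj₁ (after-cut pos cut)
      budget′ = proj₂ (after-cut pos cut)
      k<intactLines : ∀ {n} → k + suc (suc m) ≤ suc n → k < n
      k<intactLines {n} bound = ≤-trans (s≤s (m≤m+n k m))
        (≤-trans (≤-reflexive (sym (+-suc k m))) (≤-pred (subst (_≤ suc n) (+-suc k (suc m)) bound)))

    move-along : ∀ m {a b} → Survives m → CatPosition (suc m) E d a b → Cut E E′ → Intact E′ d a t →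
                 m ≤ catValue (length E′) E′ (node d a b)
    move-along zero _ _ _ _ = z≤n
    -- surviving a single further cut needs only a non-isolated target, not a crossing line
    move-along {d = d} {E′ = E′} (suc zero) {a} {b} _ pos cut line =
      catValue-≥-along line b<p (other<p b) (other≢ b) (≤-trans (m≤m+n _ 1) (proj₂ (after-cut pos cut)))
        (herderVal-positive {E′} {node d a (other b)}
           (Walk-nonisolated (walk-along line (≤-pred (other<p b)) (≤-pred b<p))
                             (other≢ b ∘ node-injective d)))
      where open CatPosition pos
    move-along (suc (suc m)) survives pos cut line =
      let b′ , b′<p , b′≢b , pos′ = next-position pos cut line
      in catValue-≥-along line b<p b′<p b′≢b (≤-trans (m≤m+n _ _) (CatPosition.budget pos′)) (survives pos′)
      where open CatPosition pos

    cat-survives : ∀ m → Survives m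
    cat-survives zero    _   = z≤n
    cat-survives (suc m) {E} {d} {a} {b} pos =
      herderVal-≥ {E} {node d a b} (CatPosition-nonisolated pos)
                  (λ cut → respond cut (intact? _ d a (proj₁ along)))
      where
      open CatPosition pos
      respond : Cut E E′ → Dec (Intact E′ d a (proj₁ along)) → m ≤ catValue (length E′) E′ (node d a b)
      respond cut (yes along′) = move-along m (cat-survives m) pos cut along′
      respond {E′} cut (no broken) = subst (λ v → m ≤ catValue (length E′) E′ v) (node-turn d a b)
        (move-along m (cat-survives m) (CatPosition-turn pos) cut
           (crossing-line-survives cut (proj₂ along) (proj₂ across) broken))

    initial-position : 1 ≤ k → CatPosition (suc (P * k)) allEdges horizontal 0 0
    initial-position 1≤k = record
      { a<p    = z<s
      ; b<p    = z<s
      ; along  = 0 , allEdges-intact horizontal z<s 1≤k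
      ; across = 0 , allEdges-intact vertical z<s 1≤k
      ; enough = λ d → ≤-reflexive (trans (+-suc k (P * k)) (cong suc (sym (intactLines-allEdges d))))
      ; budget = subst (P * 4 + suc (P * k) ≤_) (sym length-allEdges) (initial-budget P k 1≤P 1≤k)
      }

    cat-≥ : 1 ≤ k → suc (P * k) ≤ cat G
    cat-≥ 1≤k = ≤-trans (cat-survives _ (initial-position 1≤k))
                        (≤-max {xs = grVertices p k} catAt (here refl))

ratio-bound : ∀ {X Y} → 0 < X → X ≤ 12 * Y → 82944 * X < 1000000 * Y
ratio-bound {X} {Y} 0<X X≤12Y = *-cancelˡ-< 12 _ _ (begin-strict
  12 * (82944 * X)     ≡⟨ *-assoc 12 82944 X ⟨
  995328 * X           <⟨ *-monoˡ-< X {{>-nonZero 0<X}} (<ᵇ⇒< 995328 1000000 _) ⟩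
  1000000 * X          ≤⟨ *-monoʳ-≤ 1000000 X≤12Y ⟩
  1000000 * (12 * Y)   ≡⟨ trans (sym (*-assoc 1000000 12 Y)) (*-assoc 12 1000000 Y) ⟩
  12 * (1000000 * Y)   ∎)
  where open ≤-Reasoning

Gr-bounds : (p k : ℕ) → 3 ≤ p → 1 ≤ k →
       (∣V∣ (Gr p k) ≡ p * p + 2 * k * p * (p ∸ 1))
       × (Δ (Gr p k) ≡ 4 * k)
       × (Δ (Gr p k) * ∣V∣ (Gr p k) ≤ 12 * (cat (Gr p k) * cat (Gr p k)))
       × (82944 * (Δ (Gr p k) * ∣V∣ (Gr p k)) < 1000000 * (cat (Gr p k) * cat (Gr p k)))
Gr-bounds p@(suc P) k@(suc _) (s≤s 2≤P) 1≤k =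
  ∣V∣-Gr , Δ-Gr 2≤P , Δn≤12cat² ,
  -- X and Y are spelled out: unifying them against the goal would unfold 82944 * _
  ratio-bound {Δ (Gr p k) * ∣V∣ (Gr p k)} {cat (Gr p k) * cat (Gr p k)} 0<Δn Δn≤12cat²
  where
  open Grid P k using (∣V∣-Gr; Δ-Gr; module CatStrategy)
  open CatStrategy (<⇒≤ 2≤P) using (cat-≥)
  Δn≡ : Δ (Gr p k) * ∣V∣ (Gr p k) ≡ 4 * k * (p * p + 2 * k * p * P)
  Δn≡ = cong₂ _*_ (Δ-Gr 2≤P) ∣V∣-Gr
  0<Δn : 0 < Δ (Gr p k) * ∣V∣ (Gr p k)
  0<Δn = subst (0 <_) (sym Δn≡) z<s
  Δn≤12cat² : Δ (Gr p k) * ∣V∣ (Gr p k) ≤ 12 * (cat (Gr p k) * cat (Gr p k))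
  Δn≤12cat² = begin
    Δ (Gr p k) * ∣V∣ (Gr p k)          ≡⟨ Δn≡ ⟩
    4 * k * (p * p + 2 * k * p * P)    ≤⟨ cat-square-bound P k 2≤P ⟩
    12 * (suc (P * k) * suc (P * k))   ≤⟨ *-monoʳ-≤ 12 (*-mono-≤ (cat-≥ 1≤k) (cat-≥ 1≤k)) ⟩
    12 * (cat (Gr p k) * cat (Gr p k)) ∎
    where open ≤-Reasoning

mainTheorem8 : ((p k : ℕ) → 3 ≤ p → 1 ≤ k →
       (∣V∣ (Gr p k) ≡ p * p + 2 * k * p * (p ∸ 1))
       × (Δ (Gr p k) ≡ 4 * k)
       -- cat ≥ (√3/6)·√(Δ n)  ⇔  12·cat² ≥ Δ·n
       × (Δ (Gr p k) * ∣V∣ (Gr p k) ≤ 12 * (cat (Gr p k) * cat (Gr p k)))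
       -- cat > 0.288·√(Δ n)  ⇔  10⁶·cat² > 82944·Δ·n
       × (82944 * (Δ (Gr p k) * ∣V∣ (Gr p k)) < 1000000 * (cat (Gr p k) * cat (Gr p k))))
    × ((D N : ℕ) → ∃ λ p → ∃ λ k → 3 ≤ p × 1 ≤ k × D ≤ Δ (Gr p k) × N ≤ ∣V∣ (Gr p k))
mainTheorem8 = Gr-bounds , unbounded
  where
  unbounded : (D N : ℕ) → ∃ λ p → ∃ λ k → 3 ≤ p × 1 ≤ k × D ≤ Δ (Gr p k) × N ≤ ∣V∣ (Gr p k)
  unbounded D N = p , k , s≤s (s≤s (s≤s z≤n)) , s≤s z≤n , D≤Δ , N≤n
    where
    p = 3 + N
    k = suc D
    D≤Δ : D ≤ Δ (Gr p k)
    D≤Δ = subst (D ≤_) (sym (Grid.Δ-Gr (2 + N) k (s≤s (s≤s z≤n)))) (≤-trans (n≤1+n D) (m≤m+n k _))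
    N≤n : N ≤ ∣V∣ (Gr p k)
    N≤n = subst (N ≤_) (sym (Grid.∣V∣-Gr (2 + N) k))
                (≤-trans (m≤n+m N 3) (≤-trans (m≤m+n p _) (m≤m+n (p * p) _)))
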